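{- Let $p,q$ be nonzero numbers with $p\neq q$, $s\in\mathbb{R}$, $h\in\mathbb{C}\setminus\{0\}$, and let $U,V,W_p$ be elements of a unital associative complex algebra (with real powers $V^t$, $V^aV^b=V^{a+b}$) satisfying $UV-qVU=hV^sW_p$, $W_pV=pVW_p$, $UW_p=pW_pU$, and $W_p=I$ when $p=1$. Then for all $k\in\mathbb{N}=\{1,2,\dots\}$, \[UV^k-q^kV^kU=h[k]_{p,q}V^{s+k-1}W_p.\]
   Context: $[k]_{p,q}=\frac{p^k-q^k}{p-q}$. -}

module Defs where

open import Level using (Level; _⊔_; suc)
open import Data.Nat using (ℕ)
open import Algebra.Bundles using (CommutativeRing; Ring; CommutativeMonoid)
import Algebra.Bundles
open import Algebra.Morphism.Structures using (module RingMorphisms)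
import Algebra.Definitions.RawSemiring as RawSemiringDefs
import Algebra.Definitions.RawMonoid as RawMonoidDefs

record UnitalAlgebra {k ℓk} (K : CommutativeRing k ℓk) (a ℓ : Level)
       : Set (k ⊔ ℓk ⊔ suc (a ⊔ ℓ)) where
  field
    ring : Ring a ℓ
  open Ring ring public
  field
    ι         : CommutativeRing.Carrier K → Carrier
    ι-hom     : RingMorphisms.IsRingHomomorphism (CommutativeRing.rawRing K) rawRing ι
    ι-central : ∀ c x → ι c * x ≈ x * ι c

  infixr 7 _·_
  _·_ : CommutativeRing.Carrier K → Carrier → Carrier
  c · x = ι c * x

  open RawSemiringDefs (Algebra.Bundles.RawRing.rawSemiring rawRing) public using (_^_)

  open CommutativeRing K public using ()
    renaming (Carrier to 𝕂; _≈_ to _≈ₖ_; _*_ to _*ₖ_; _-_ to _-ₖ_; 0# to 0ₖ; 1# to 1ₖ)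

-- "Real" powers of an element V of an algebra A, indexed by an abstract
-- additive commutative monoid of exponents E with a distinguished unit
-- exponent 1ᴱ (for the paper: E = (ℝ, +, 0) and 1ᴱ = 1).
record Powers {k ℓk a ℓ e ℓe} {K : CommutativeRing k ℓk}
       (A : UnitalAlgebra K a ℓ) (E : CommutativeMonoid e ℓe)
       (1ᴱ : CommutativeMonoid.Carrier E) (V : UnitalAlgebra.Carrier A)
       : Set (a ⊔ ℓ ⊔ e ⊔ ℓe) where
  open UnitalAlgebra A
  module E = CommutativeMonoid E
  field
    pow      : E.Carrier → Carrier
    pow-cong : ∀ {s t} → s E.≈ t → pow s ≈ pow t
    pow-+    : ∀ s t → pow (s E.∙ t) ≈ pow s * pow t
    pow-1    : pow 1ᴱ ≈ V

natExp : ∀ {e ℓe} (E : CommutativeMonoid e ℓe) → CommutativeMonoid.Carrier E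
         → ℕ → CommutativeMonoid.Carrier E
natExp E 1ᴱ n = n × 1ᴱ
  where open RawMonoidDefs (CommutativeMonoid.rawMonoid E) using (_×_)

scalarPow : ∀ {k ℓk} (K : CommutativeRing k ℓk) → CommutativeRing.Carrier K → ℕ
            → CommutativeRing.Carrier K
scalarPow K x n = x ^ n
  where open RawSemiringDefs (Algebra.Bundles.RawRing.rawSemiring (CommutativeRing.rawRing K)) using (_^_)

-- [n]_{p,q} = (p^n - q^n)/(p - q), where d is the given inverse of (p - q).
qnum : ∀ {k ℓk} (K : CommutativeRing k ℓk) (d p q : CommutativeRing.Carrier K) → ℕ
       → CommutativeRing.Carrier K
qnum K d p q n = (scalarPow K p n - scalarPow K q n) * d
  where open CommutativeRing K using (_-_; _*_)

{-# OPTIONS --safe #-}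
-- Write X n = U Vⁿ - qⁿ Vⁿ U.  Expanding X (n + 1) and cancelling the middle
-- term gives X (n + 1) = X 1 Vⁿ + q V X n.  Since X 1 = h V^s W and W Vⁿ = pⁿ Vⁿ W,
-- the first summand is h pⁿ V^(s+n) W; by induction the second is
-- h q [n] V^(s+n) W, and pⁿ + q [n] = [n+1].
module Submission where

open import Defs
open import Level using (Level)
open import Data.Nat using (ℕ; zero; suc; _≤_; _∸_)
open import Algebra.Bundles using (CommutativeRing; CommutativeMonoid; Ring)
open import Algebra.Morphism.Structures using (module RingMorphisms)
open import Relation.Nullary using (¬_)
import Algebra.Properties.Ring as RingProperties
import Relation.Binary.Reasoning.Setoid as SetoidReasoning

module _ {a ℓ} (R : Ring a ℓ) where
  open Ring R
  open SetoidReasoning setoid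

  [x-y]+[y-z]≈x-z : ∀ x y z → (x - y) + (y - z) ≈ x - z
  [x-y]+[y-z]≈x-z x y z = begin
    (x - y) + (y - z)   ≈⟨ +-assoc x (- y) (y - z) ⟩
    x + (- y + (y - z)) ≈⟨ +-congˡ (+-assoc (- y) y (- z)) ⟨
    x + ((- y + y) - z) ≈⟨ +-congˡ (+-congʳ (-‿inverseˡ y)) ⟩
    x + (0# - z)        ≈⟨ +-congˡ (+-identityˡ (- z)) ⟩
    x - z               ∎

module QNumber {k ℓk} (K : CommutativeRing k ℓk) where
  open CommutativeRing K
  open RingProperties ring using (x[y-z]≈xy-xz)
  open SetoidReasoning setoid

  private
    infixr 8 _^_
    _^_ : Carrier → ℕ → Carrier
    _^_ = scalarPow K

  qnum-one : ∀ {d p q} → d * (p - q) ≈ 1# → qnum K d p q 1 ≈ 1#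
  qnum-one {d} {p} {q} d-inv = begin
    (p * 1# - q * 1#) * d ≈⟨ *-congʳ (+-cong (*-identityʳ p) (-‿cong (*-identityʳ q))) ⟩
    (p - q) * d           ≈⟨ *-comm _ d ⟩
    d * (p - q)           ≈⟨ d-inv ⟩
    1#                    ∎

  qnum-suc : ∀ {d p q} → d * (p - q) ≈ 1# → ∀ n →
             qnum K d p q (suc n) ≈ p ^ n + q * qnum K d p q n
  qnum-suc {d} {p} {q} d-inv n = begin
    (p * p ^ n - q * q ^ n) * d
      ≈⟨ *-congʳ numerator ⟨
    (p ^ n * (p - q) + q * (p ^ n - q ^ n)) * d
      ≈⟨ distribʳ d _ _ ⟩
    p ^ n * (p - q) * d + q * (p ^ n - q ^ n) * d
      ≈⟨ +-cong (*-assoc _ _ d) (*-assoc q _ d) ⟩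
    p ^ n * ((p - q) * d) + q * qnum K d p q n
      ≈⟨ +-congʳ (*-congˡ (trans (*-comm _ d) d-inv)) ⟩
    p ^ n * 1# + q * qnum K d p q n
      ≈⟨ +-congʳ (*-identityʳ _) ⟩
    p ^ n + q * qnum K d p q n ∎
    where
    numerator : p ^ n * (p - q) + q * (p ^ n - q ^ n) ≈ p * p ^ n - q * q ^ n
    numerator = begin
      p ^ n * (p - q) + q * (p ^ n - q ^ n)
        ≈⟨ +-cong (x[y-z]≈xy-xz _ p q) (x[y-z]≈xy-xz q _ _) ⟩
      (p ^ n * p - p ^ n * q) + (q * p ^ n - q * q ^ n)
        ≈⟨ +-congʳ (+-cong (*-comm _ p) (-‿cong (*-comm _ q))) ⟩
      (p * p ^ n - q * p ^ n) + (q * p ^ n - q * q ^ n)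
        ≈⟨ [x-y]+[y-z]≈x-z ring _ _ _ ⟩
      p * p ^ n - q * q ^ n ∎

module AlgebraProperties {k ℓk a ℓ} {K : CommutativeRing k ℓk} (A : UnitalAlgebra K a ℓ) where
  open UnitalAlgebra A
  private module K = CommutativeRing K
  open RingMorphisms.IsRingHomomorphism ι-hom
  open RingProperties ring using (x[y-z]≈xy-xz; [y-z]x≈yx-zx)
  open SetoidReasoning setoid

  ·-cong : ∀ {b c x y} → b ≈ₖ c → x ≈ y → b · x ≈ c · y
  ·-cong b≈c x≈y = *-cong (⟦⟧-cong b≈c) x≈y

  ·-congˡ : ∀ {c x y} → x ≈ y → c · x ≈ c · y
  ·-congˡ = *-congˡ

  ·-identityˡ : ∀ x → 1ₖ · x ≈ x
  ·-identityˡ x = trans (*-congʳ 1#-homo) (*-identityˡ x)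

  ·-assoc : ∀ b c x → (b *ₖ c) · x ≈ b · (c · x)
  ·-assoc b c x = trans (*-congʳ (*-homo b c)) (*-assoc (ι b) (ι c) x)

  ·-comm : ∀ b c x → b · (c · x) ≈ c · (b · x)
  ·-comm b c x = begin
    b · (c · x)   ≈⟨ ·-assoc b c x ⟨
    (b *ₖ c) · x  ≈⟨ ·-cong (K.*-comm b c) refl ⟩
    (c *ₖ b) · x  ≈⟨ ·-assoc c b x ⟩
    c · (b · x)   ∎

  ·-distribʳ : ∀ b c x → (b K.+ c) · x ≈ b · x + c · x
  ·-distribʳ b c x = trans (*-congʳ (+-homo b c)) (distribʳ x (ι b) (ι c))

  ·-distribˡ : ∀ c x y → c · (x + y) ≈ c · x + c · y
  ·-distribˡ c = distribˡ (ι c)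

  ·-distrib-‿ : ∀ c x y → c · (x - y) ≈ c · x - c · y
  ·-distrib-‿ c = x[y-z]≈xy-xz (ι c)

  ·-*-assoc : ∀ c x y → (c · x) * y ≈ c · (x * y)
  ·-*-assoc c = *-assoc (ι c)

  *-·-comm : ∀ c x y → x * (c · y) ≈ c · (x * y)
  *-·-comm c x y = begin
    x * (ι c * y) ≈⟨ *-assoc x (ι c) y ⟨
    (x * ι c) * y ≈⟨ *-congʳ (ι-central c x) ⟨
    (ι c * x) * y ≈⟨ *-assoc (ι c) x y ⟩
    ι c * (x * y) ∎

  qCommutator : 𝕂 → Carrier → Carrier → Carrier
  qCommutator q U V = U * V - q · (V * U)

  qCommutator-^-one : ∀ q U V → qCommutator (scalarPow K q 1) U (V ^ 1) ≈ qCommutator q U V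
  qCommutator-^-one q U V =
    +-cong (*-congˡ (*-identityʳ V)) (-‿cong (·-cong (K.*-identityʳ q) (*-congʳ (*-identityʳ V))))

  qCommutator-^-suc : ∀ q U V n →
    qCommutator (scalarPow K q (suc n)) U (V ^ suc n)
      ≈ qCommutator q U V * V ^ n + q · (V * qCommutator (scalarPow K q n) U (V ^ n))
  qCommutator-^-suc q U V n = sym (begin
    qCommutator q U V * V ^ n + q · (V * (U * V ^ n - qⁿ · (V ^ n * U)))
      ≈⟨ +-cong first second ⟩
    (U * (V * V ^ n) - q · (V * (U * V ^ n)))
      + (q · (V * (U * V ^ n)) - (q *ₖ qⁿ) · ((V * V ^ n) * U))
      ≈⟨ [x-y]+[y-z]≈x-z ring _ _ _ ⟩
    U * (V * V ^ n) - (q *ₖ qⁿ) · ((V * V ^ n) * U) ∎)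
    where
    qⁿ : 𝕂
    qⁿ = scalarPow K q n
    first : qCommutator q U V * V ^ n ≈ U * (V * V ^ n) - q · (V * (U * V ^ n))
    first = trans ([y-z]x≈yx-zx (V ^ n) (U * V) (q · (V * U)))
      (+-cong (*-assoc U V (V ^ n))
              (-‿cong (trans (·-*-assoc q _ _) (·-congˡ (*-assoc V U (V ^ n))))))
    second : q · (V * (U * V ^ n - qⁿ · (V ^ n * U)))
             ≈ q · (V * (U * V ^ n)) - (q *ₖ qⁿ) · ((V * V ^ n) * U)
    second = begin
      q · (V * (U * V ^ n - qⁿ · (V ^ n * U)))
        ≈⟨ trans (·-congˡ (x[y-z]≈xy-xz V _ _)) (·-distrib-‿ q _ _) ⟩
      q · (V * (U * V ^ n)) - q · (V * (qⁿ · (V ^ n * U)))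
        ≈⟨ +-congˡ (-‿cong (·-congˡ (*-·-comm qⁿ V _))) ⟩
      q · (V * (U * V ^ n)) - q · (qⁿ · (V * (V ^ n * U)))
        ≈⟨ +-congˡ (-‿cong (trans (·-congˡ (*-assoc V (V ^ n) U)) (·-assoc q qⁿ _))) ⟨
      q · (V * (U * V ^ n)) - (q *ₖ qⁿ) · ((V * V ^ n) * U) ∎

  twisted-^ : ∀ {p W V} → W * V ≈ p · (V * W) → ∀ n → W * V ^ n ≈ scalarPow K p n · (V ^ n * W)
  twisted-^ {p} {W} {V} WV≈pVW zero =
    trans (*-identityʳ W) (sym (trans (·-identityˡ _) (*-identityˡ W)))
  twisted-^ {p} {W} {V} WV≈pVW (suc n) = begin
    W * (V * V ^ n)               ≈⟨ *-assoc W V (V ^ n) ⟨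
    (W * V) * V ^ n               ≈⟨ *-congʳ WV≈pVW ⟩
    (p · (V * W)) * V ^ n         ≈⟨ trans (·-*-assoc p _ _) (·-congˡ (*-assoc V W (V ^ n))) ⟩
    p · (V * (W * V ^ n))         ≈⟨ ·-congˡ (*-congˡ (twisted-^ WV≈pVW n)) ⟩
    p · (V * (pⁿ · (V ^ n * W)))  ≈⟨ ·-congˡ (*-·-comm pⁿ V _) ⟩
    p · (pⁿ · (V * (V ^ n * W)))  ≈⟨ ·-assoc p pⁿ _ ⟨
    (p *ₖ pⁿ) · (V * (V ^ n * W)) ≈⟨ ·-congˡ (*-assoc V (V ^ n) W) ⟨
    (p *ₖ pⁿ) · ((V * V ^ n) * W) ∎
    where
    pⁿ : 𝕂
    pⁿ = scalarPow K p n

module PowersProperties {k ℓk a ℓ e ℓe} {K : CommutativeRing k ℓk} {A : UnitalAlgebra K a ℓ}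
    {E : CommutativeMonoid e ℓe} {1ᴱ : CommutativeMonoid.Carrier E} {V : UnitalAlgebra.Carrier A}
    (P : Powers A E 1ᴱ V) where
  open UnitalAlgebra A
  open Powers P
  open SetoidReasoning setoid

  pow-*-V : ∀ t → pow t * V ≈ pow (t E.∙ 1ᴱ)
  pow-*-V t = trans (*-congˡ (sym pow-1)) (sym (pow-+ t 1ᴱ))

  V-*-pow : ∀ t → V * pow t ≈ pow (t E.∙ 1ᴱ)
  V-*-pow t = begin
    V * pow t         ≈⟨ *-congʳ pow-1 ⟨
    pow 1ᴱ * pow t    ≈⟨ pow-+ 1ᴱ t ⟨
    pow (1ᴱ E.∙ t)    ≈⟨ pow-cong (E.comm 1ᴱ t) ⟩
    pow (t E.∙ 1ᴱ)    ∎

  pow-*-^ : ∀ t n → pow t * V ^ n ≈ pow (t E.∙ natExp E 1ᴱ n)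
  pow-*-^ t zero    = trans (*-identityʳ (pow t)) (pow-cong (E.sym (E.identityʳ t)))
  pow-*-^ t (suc n) = begin
    pow t * (V * V ^ n)                   ≈⟨ *-assoc (pow t) V (V ^ n) ⟨
    (pow t * V) * V ^ n                   ≈⟨ *-congʳ (pow-*-V t) ⟩
    pow (t E.∙ 1ᴱ) * V ^ n                ≈⟨ pow-*-^ (t E.∙ 1ᴱ) n ⟩
    pow ((t E.∙ 1ᴱ) E.∙ natExp E 1ᴱ n)    ≈⟨ pow-cong (E.assoc t 1ᴱ _) ⟩
    pow (t E.∙ natExp E 1ᴱ (suc n))       ∎

  V-*-pow-natExp : ∀ s n → V * pow (s E.∙ natExp E 1ᴱ n) ≈ pow (s E.∙ natExp E 1ᴱ (suc n))
  V-*-pow-natExp s n = begin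
    V * pow (s E.∙ x)           ≈⟨ V-*-pow (s E.∙ x) ⟩
    pow ((s E.∙ x) E.∙ 1ᴱ)      ≈⟨ pow-cong (E.assoc s x 1ᴱ) ⟩
    pow (s E.∙ (x E.∙ 1ᴱ))      ≈⟨ pow-cong (E.∙-congˡ (E.comm x 1ᴱ)) ⟩
    pow (s E.∙ (1ᴱ E.∙ x))      ∎
    where
    x : E.Carrier
    x = natExp E 1ᴱ n

module QCommutatorPowers {k ℓk a ℓ e ℓe} {K : CommutativeRing k ℓk} {A : UnitalAlgebra K a ℓ}
    {E : CommutativeMonoid e ℓe} {1ᴱ : CommutativeMonoid.Carrier E} {V : UnitalAlgebra.Carrier A}
    (P : Powers A E 1ᴱ V) where
  open UnitalAlgebra A
  open AlgebraProperties A
  open Powers P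
  open PowersProperties P
  open QNumber K using (qnum-one; qnum-suc)
  open SetoidReasoning setoid

  module _ {p q d : 𝕂} (d-inv : d *ₖ (p -ₖ q) ≈ₖ 1ₖ) {s : E.Carrier} {h : 𝕂} {U W : Carrier}
      (UV : qCommutator q U V ≈ h · (pow s * W)) (WV : W * V ≈ p · (V * W)) where

    private
      [_] : ℕ → 𝕂
      [_] = qnum K d p q

      V^s+_ : ℕ → Carrier
      V^s+ n = pow (s E.∙ natExp E 1ᴱ n)

    leading-term : ∀ n → qCommutator q U V * V ^ n ≈ h · (scalarPow K p n · (V^s+ n * W))
    leading-term n = begin
      qCommutator q U V * V ^ n          ≈⟨ *-congʳ UV ⟩
      (h · (pow s * W)) * V ^ n          ≈⟨ trans (·-*-assoc h _ _) (·-congˡ (*-assoc _ W _)) ⟩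
      h · (pow s * (W * V ^ n))          ≈⟨ ·-congˡ (*-congˡ (twisted-^ WV n)) ⟩
      h · (pow s * (pⁿ · (V ^ n * W)))   ≈⟨ ·-congˡ (*-·-comm pⁿ _ _) ⟩
      h · (pⁿ · (pow s * (V ^ n * W)))   ≈⟨ ·-congˡ (·-congˡ (*-assoc _ _ W)) ⟨
      h · (pⁿ · ((pow s * V ^ n) * W))   ≈⟨ ·-congˡ (·-congˡ (*-congʳ (pow-*-^ s n))) ⟩
      h · (pⁿ · (V^s+ n * W))            ∎
      where
      pⁿ : 𝕂
      pⁿ = scalarPow K p n

    shifted-term : ∀ c n → q · (V * (h · (c · (V^s+ n * W)))) ≈ h · ((q *ₖ c) · (V^s+ suc n * W))
    shifted-term c n = begin
      q · (V * (h · (c · (V^s+ n * W))))  ≈⟨ ·-congˡ (*-·-comm h V _) ⟩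
      q · (h · (V * (c · (V^s+ n * W))))  ≈⟨ ·-congˡ (·-congˡ (*-·-comm c V _)) ⟩
      q · (h · (c · (V * (V^s+ n * W))))  ≈⟨ ·-congˡ (·-congˡ (·-congˡ (*-assoc V _ W))) ⟨
      q · (h · (c · ((V * V^s+ n) * W)))  ≈⟨ ·-congˡ (·-congˡ (·-congˡ (*-congʳ (V-*-pow-natExp s n)))) ⟩
      q · (h · (c · (V^s+ suc n * W)))    ≈⟨ ·-comm q h _ ⟩
      h · (q · (c · (V^s+ suc n * W)))    ≈⟨ ·-congˡ (·-assoc q c _) ⟨
      h · ((q *ₖ c) · (V^s+ suc n * W))   ∎

    qCommutator-^ : ∀ n →
      qCommutator (scalarPow K q (suc n)) U (V ^ suc n) ≈ h · ([ suc n ] · (V^s+ n * W))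
    qCommutator-^ zero = begin
      qCommutator (scalarPow K q 1) U (V ^ 1) ≈⟨ qCommutator-^-one q U V ⟩
      qCommutator q U V                       ≈⟨ UV ⟩
      h · (pow s * W)                         ≈⟨ ·-congˡ (*-congʳ (pow-cong (E.sym (E.identityʳ s)))) ⟩
      h · (V^s+ 0 * W)                        ≈⟨ ·-congˡ (·-identityˡ _) ⟨
      h · (1ₖ · (V^s+ 0 * W))                 ≈⟨ ·-congˡ (·-cong (qnum-one d-inv) refl) ⟨
      h · ([ 1 ] · (V^s+ 0 * W))              ∎
    qCommutator-^ (suc n) = begin
      qCommutator (scalarPow K q (2+n)) U (V ^ 2+n)
        ≈⟨ qCommutator-^-suc q U V (suc n) ⟩
      qCommutator q U V * V ^ suc n + q · (V * qCommutator (scalarPow K q (suc n)) U (V ^ suc n))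
        ≈⟨ +-cong (leading-term (suc n)) (·-congˡ (*-congˡ (qCommutator-^ n))) ⟩
      h · (pⁿ⁺¹ · Y) + q · (V * (h · ([ suc n ] · (V^s+ n * W))))
        ≈⟨ +-congˡ (shifted-term [ suc n ] n) ⟩
      h · (pⁿ⁺¹ · Y) + h · ((q *ₖ [ suc n ]) · Y)
        ≈⟨ trans (·-congˡ (·-distribʳ _ _ Y)) (·-distribˡ h _ _) ⟨
      h · ((pⁿ⁺¹ K.+ q *ₖ [ suc n ]) · Y)
        ≈⟨ ·-congˡ (·-cong (qnum-suc d-inv (suc n)) refl) ⟨
      h · ([ 2+n ] · Y) ∎
      where
      module K = CommutativeRing K
      2+n : ℕ
      2+n = suc (suc n)
      pⁿ⁺¹ : 𝕂
      pⁿ⁺¹ = scalarPow K p (suc n)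
      Y : Carrier
      Y = V^s+ suc n * W

proposition3p1 : ∀ {k ℓk a ℓ e ℓe : Level}
  (K : CommutativeRing k ℓk) (A : UnitalAlgebra K a ℓ)
  (E : CommutativeMonoid e ℓe) (1ᴱ : CommutativeMonoid.Carrier E) →
  let open UnitalAlgebra A
      open CommutativeMonoid E using (_∙_)
  in
  (p q d : 𝕂) → ¬ (p ≈ₖ 0ₖ) → ¬ (q ≈ₖ 0ₖ) → ¬ (p ≈ₖ q) → d *ₖ (p -ₖ q) ≈ₖ 1ₖ →
  (s : CommutativeMonoid.Carrier E) (h : 𝕂) → ¬ (h ≈ₖ 0ₖ) →
  (U V W : Carrier) (P : Powers A E 1ᴱ V) →
  U * V - q · (V * U) ≈ h · (Powers.pow P s * W) →
  W * V ≈ p · (V * W) →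
  U * W ≈ p · (W * U) →
  (p ≈ₖ 1ₖ → W ≈ 1#) →
  (n : ℕ) → 1 ≤ n →
  U * V ^ n - scalarPow K q n · (V ^ n * U)
    ≈ h · (qnum K d p q n · (Powers.pow P (s ∙ natExp E 1ᴱ (n ∸ 1)) * W))
-- Nonvanishing, U W = p W U and the case p = 1 are not needed; p ≠ q enters only through d.
proposition3p1 K A E 1ᴱ p q d _ _ _ d-inv s h _ U V W P UV WV _ _ zero ()
proposition3p1 K A E 1ᴱ p q d _ _ _ d-inv s h _ U V W P UV WV _ _ (suc n) _ =
  QCommutatorPowers.qCommutator-^ P d-inv UV WV n
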